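{- Let $G$ be a finite cyclic group. Then there exists a graph $\Gamma$ with $\mathcal{P}^{**}(G)=L(\Gamma)$ if and only if $G\cong\mathbb{Z}_{p^t}$ or $G\cong\mathbb{Z}_{pq}$, where $p,q$ are distinct primes and $t\geq 1$.
   Context: For a finite group $G$, the power graph $\mathcal{P}(G)$ is the simple graph with vertex set $G$ in which two distinct vertices $u,v$ are adjacent iff $u^m=v$ or $v^n=u$ for some positive integers $m,n$. The proper power graph $\mathcal{P}^{**}(G)$ is obtained from $\mathcal{P}(G)$ by deleting all dominating vertices (vertices adjacent to all other vertices). $L(\Gamma)$ denotes the line graph of $\Gamma$: its vertices are the edges of $\Gamma$, two adjacent iff they share an endpoint. -}

module Defs where

open import Data.Nat using (ℕ; zero; suc; _+_; _*_; _^_; _≤_; NonZero)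
open import Data.Nat.DivMod using (_%_)
open import Data.Fin using (Fin; toℕ; _<_)
open import Data.Product using (∃-syntax; _×_)
open import Data.Sum using (_⊎_)
open import Relation.Nullary using (¬_)
open import Relation.Binary.PropositionalEquality using (_≡_; _≢_)
open import Function.Bundles using (_↔_; _⇔_; Inverse)

record Graph : Set₁ where
  field
    Vertex : Set
    Adj    : Vertex → Vertex → Set

record SimpleGraph (m : ℕ) : Set₁ where
  field
    Adj     : Fin m → Fin m → Set
    symm    : ∀ {x y} → Adj x y → Adj y x
    irrefl  : ∀ {x} → ¬ Adj x x

record _≅_ (Γ Δ : Graph) : Set where
  private
    module Γ = Graph Γ
    module Δ = Graph Δ
  field
    bij      : Γ.Vertex ↔ Δ.Vertex
    adj-iff  : ∀ x y → Γ.Adj x y ⇔ Δ.Adj (Inverse.to bij x) (Inverse.to bij y)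

-- Line graph of a simple graph on Fin m.
-- An edge is an unordered pair {u , v}, represented with u < v.
-- (Proof fields are irrelevant, so an edge is determined by u and v.)

record Edge {m : ℕ} (Γ : SimpleGraph m) : Set where
  constructor edge
  field
    u v   : Fin m
    .u<v  : u < v
    .adj  : SimpleGraph.Adj Γ u v

open Edge

LineAdj : ∀ {m} (Γ : SimpleGraph m) → Edge Γ → Edge Γ → Set
LineAdj Γ e f =
  e ≢ f × (u e ≡ u f ⊎ u e ≡ v f ⊎ v e ≡ u f ⊎ v e ≡ v f)

LineGraph : ∀ {m} → SimpleGraph m → Graph
LineGraph Γ = record { Vertex = Edge Γ ; Adj = LineAdj Γ }

-- The cyclic group ℤ_n = {0,…,n-1} under addition mod n.
-- The m-th power of u (additive notation) is m·u mod n.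

module _ (n : ℕ) .{{_ : NonZero n}} where

  pow : ℕ → Fin n → ℕ
  pow k x = (k * toℕ x) % n

  PowAdj : Fin n → Fin n → Set
  PowAdj x y = x ≢ y × ((∃[ k ] pow (suc k) x ≡ toℕ y) ⊎ (∃[ k ] pow (suc k) y ≡ toℕ x))

  PowerGraph : Graph
  PowerGraph = record { Vertex = Fin n ; Adj = PowAdj }

  Dominating : Fin n → Set
  Dominating x = ∀ y → y ≢ x → PowAdj x y

  record NonDom : Set where
    constructor nondom
    field
      elem    : Fin n
      .notDom : ¬ Dominating elem

  ProperPowerGraph : Graph
  ProperPowerGraph = record
    { Vertex = NonDom
    ; Adj    = λ a b → PowAdj (NonDom.elem a) (NonDom.elem b) }

-- In ℤ_n the element y is a power of x iff ⟨y⟩ ⊆ ⟨x⟩, i.e. iff gcd(x,n) divides gcd(y,n);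
-- so two elements are adjacent in the power graph iff these indices are comparable under
-- divisibility.  If n = p^t all subgroups form a chain, every vertex is dominating and
-- P**(ℤ_n) is empty, the line graph of an edgeless graph.  If n = pq, P**(ℤ_n) consists of
-- the two cliques of elements of order p and of order q, the line graph of two stars.
-- Otherwise p²q or pqr divides n, and subgroups built from these primes supply six vertices
-- in a configuration that no line graph contains: a K₄ {c₁, c₂, d₁, d₂}, a vertex a adjacent
-- to c₁ and c₂ but not to d₁, and a vertex b adjacent to a but to neither c₁ nor c₂.

module Submission where

open import Defs
open import Data.Nat
  using (ℕ; zero; suc; pred; _+_; _*_; _∸_; _^_; _≤_; _<_; _≟_; NonZero; ≢-nonZero; ≢-nonZero⁻¹; >-nonZero⁻¹; nonTrivial⇒n>1; z≤n; s≤s)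
open import Data.Nat.Properties
open import Data.Nat.DivMod using (_%_; [m+kn]%n≡m%n; %-distribˡ-*; m<n⇒m%n≡m)
open import Data.Nat.Divisibility
open import Data.Nat.GCD using (gcd; gcd[m,n]∣m; gcd[m,n]∣n; gcd-greatest; gcd-GCD; module Bézout)
open import Data.Nat.Coprimality using (Coprime; coprime-divisor)
open import Data.Nat.Primality
  using (Prime; euclidsLemma; prime⇒irreducible; prime⇒nonZero; prime⇒nonTrivial; productOfPrimes≢0)
open import Data.Nat.Primality.Factorisation using (factorise)
open import Data.Nat.ListAction using (product)
open import Data.Nat.Tactic.RingSolver using (solve-∀)
open import Algebra.Properties.CommutativeSemigroup *-commutativeSemigroup using (x∙yz≈y∙xz)
open import Data.Fin using (Fin; toℕ; fromℕ<)
open import Data.Fin.Properties as Fin using (toℕ<n; toℕ-fromℕ<)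
open import Data.List using ([]; _∷_; length)
open import Data.List.Relation.Unary.All using (All; []; _∷_)
open import Data.Product using (Σ; ∃-syntax; _×_; _,_; proj₁; proj₂)
import Data.Product as Product
open import Data.Sum using (_⊎_; inj₁; inj₂; [_,_]; swap)
import Data.Sum as Sum
open import Data.Empty using (⊥; ⊥-elim)
import Data.Empty.Irrelevant as Irrelevant
open import Function using (_∘_)
open import Function.Bundles using (_⇔_; mk⇔; Equivalence; Inverse; mk↔ₛ′)
open import Function.Construct.Composition using (_⇔-∘_)
open import Function.Construct.Symmetry using (⇔-sym)
open import Relation.Nullary using (¬_; Dec; yes; no; contradiction)
open import Relation.Nullary.Decidable using (decidable-stable; _⊎-dec_; map′)
open import Relation.Binary.PropositionalEquality hiding ([_])

-- Divisibility and primes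

Comparable : ℕ → ℕ → Set
Comparable m n = m ∣ n ⊎ n ∣ m

StrictlyComparable : ℕ → ℕ → Set
StrictlyComparable m n = m ≢ n × Comparable m n

strictlyComparable-sym : ∀ {m n} → StrictlyComparable m n → StrictlyComparable n m
strictlyComparable-sym = Product.map ≢-sym swap

strictlyComparable-* : ∀ m {k l} .{{_ : NonZero m}} → 1 < k → l ≡ m * k → StrictlyComparable m l
strictlyComparable-* m {k} 1<k refl = <⇒≢ (m<m*n m k 1<k) , inj₁ (m∣m*n k)

incomparable⇒≢ : ∀ {m n} → ¬ Comparable m n → m ≢ n
incomparable⇒≢ m≁n refl = m≁n (inj₁ ∣-refl)

incomparable-*ˡ : ∀ m {a b} .{{_ : NonZero m}} → ¬ Comparable a b → ¬ Comparable (m * a) (m * b)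
incomparable-*ˡ m a≁b = a≁b ∘ Sum.map (*-cancelˡ-∣ m) (*-cancelˡ-∣ m)

∣m∣n⇒∣m∸n : ∀ {d m n} → d ∣ m → d ∣ n → d ∣ m ∸ n
∣m∣n⇒∣m∸n {d} (divides a refl) (divides b refl) = divides (a ∸ b) (sym (*-distribʳ-∸ d a b))

∣∧<⇒≡0 : ∀ {m x} → m ∣ x → x < m → x ≡ 0
∣∧<⇒≡0 {x = zero}  _   _   = refl
∣∧<⇒≡0 {x = suc x} m∣x x<m = contradiction (∣⇒≤ m∣x) (<⇒≱ x<m)

gcd[d,n]≡d : ∀ {d n} → d ∣ n → gcd d n ≡ d
gcd[d,n]≡d {d} {n} d∣n = ∣-antisym (gcd[m,n]∣m d n) (gcd-greatest ∣-refl d∣n)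

gcd[n∸d,n]≡d : ∀ {d n} → d ∣ n → d ≤ n → gcd (n ∸ d) n ≡ d
gcd[n∸d,n]≡d {d} {n} d∣n d≤n = ∣-antisym
  (∣m+n∣m⇒∣n (subst (gcd (n ∸ d) n ∣_) (sym (m∸n+n≡m d≤n)) (gcd[m,n]∣n (n ∸ d) n))
              (gcd[m,n]∣m (n ∸ d) n))
  (gcd-greatest (∣m∣n⇒∣m∸n d∣n ∣-refl) d∣n)

prime>1 : ∀ {p} → Prime p → 1 < p
prime>1 {p} pp = nonTrivial⇒n>1 p {{prime⇒nonTrivial pp}}

prime∤prime : ∀ {p q} → Prime p → Prime q → p ≢ q → ¬ p ∣ q
prime∤prime pp pq p≢q p∣q with prime⇒irreducible pq p∣q
... | inj₁ p≡1 = <⇒≢ (prime>1 pp) (sym p≡1)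
... | inj₂ p≡q = p≢q p≡q

primes-incomparable : ∀ {p q} → Prime p → Prime q → p ≢ q → ¬ Comparable p q
primes-incomparable pp pq p≢q = [ prime∤prime pp pq p≢q , prime∤prime pq pp (≢-sym p≢q) ]

prime≢2⇒prime>2 : ∀ {p} → Prime p → p ≢ 2 → 2 < p
prime≢2⇒prime>2 pp p≢2 = ≤∧≢⇒< (prime>1 pp) (≢-sym p≢2)

∣p^t⇒≡p^i : ∀ {p d} → Prime p → ∀ t → d ∣ p ^ t → ∃[ i ] d ≡ p ^ i
∣p^t⇒≡p^i {p} {d} pp zero d∣1 = 0 , ∣1⇒≡1 d∣1
∣p^t⇒≡p^i {p} {d} pp (suc t) d∣p^[1+t] with p ∣? d
... | yes (divides d′ refl) =
  let i , d′≡p^i = ∣p^t⇒≡p^i pp t (*-cancelʳ-∣ p {{prime⇒nonZero pp}} (subst (d′ * p ∣_) (*-comm p _) d∣p^[1+t]))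
  in suc i , trans (*-comm d′ p) (cong (p *_) d′≡p^i)
... | no p∤d = ∣p^t⇒≡p^i pp t (coprime-divisor d⊥p d∣p^[1+t])
  where
  d⊥p : Coprime d p
  d⊥p (e∣d , e∣p) with prime⇒irreducible pp e∣p
  ... | inj₁ e≡1 = e≡1
  ... | inj₂ refl = contradiction e∣d p∤d

powers-comparable : ∀ p i j → Comparable (p ^ i) (p ^ j)
powers-comparable p i j with ≤-total i j
... | inj₁ i≤j = inj₁ (divides (p ^ (j ∸ i)) (trans (cong (p ^_) (sym (m+[n∸m]≡n i≤j)))
                                             (trans (^-distribˡ-+-* p i (j ∸ i)) (*-comm (p ^ i) _))))
... | inj₂ j≤i = inj₂ (divides (p ^ (i ∸ j)) (trans (cong (p ^_) (sym (m+[n∸m]≡n j≤i)))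
                                             (trans (^-distribˡ-+-* p j (i ∸ j)) (*-comm (p ^ j) _))))

prime-power-divisors-comparable : ∀ {p a b} → Prime p → ∀ t → a ∣ p ^ t → b ∣ p ^ t → Comparable a b
prime-power-divisors-comparable {p} pp t a∣p^t b∣p^t
  with ∣p^t⇒≡p^i pp t a∣p^t | ∣p^t⇒≡p^i pp t b∣p^t
... | i , refl | j , refl = powers-comparable p i j

distinct-primes-∣⇒∣* : ∀ {p q x} → Prime p → Prime q → p ≢ q → p ∣ x → q ∣ x → p * q ∣ x
distinct-primes-∣⇒∣* {p} {q} pp pq p≢q (divides k refl) q∣k*p
  with euclidsLemma k p pq q∣k*p
... | inj₁ (divides j refl) = divides j (trans (*-assoc j q p) (cong (j *_) (*-comm q p)))
... | inj₂ q∣p = contradiction q∣p (prime∤prime pq pp (≢-sym p≢q))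

gcd[x,a*b]∣a : ∀ {a b x} → Prime b → ¬ b ∣ x → gcd x (a * b) ∣ a
gcd[x,a*b]∣a {a} {b} {x} pb b∤x =
  coprime-divisor g⊥b (subst (gcd x (a * b) ∣_) (*-comm a b) (gcd[m,n]∣n x (a * b)))
  where
  g⊥b : Coprime (gcd x (a * b)) b
  g⊥b (d∣g , d∣b) with prime⇒irreducible pb d∣b
  ... | inj₁ d≡1 = d≡1
  ... | inj₂ refl = contradiction (∣-trans d∣g (gcd[m,n]∣m x (a * b))) b∤x

module _ (n : ℕ) .{{_ : NonZero n}} where
  open ≡-Reasoning

  gcd-multiple : ∀ a → ∃[ c ] (c * a) % n ≡ gcd a n % n
  gcd-multiple a with Bézout.identity (gcd-GCD a n)
  ... | Bézout.+- x y g+yn≡xa = x , (begin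
    (x * a) % n              ≡⟨ cong (_% n) g+yn≡xa ⟨
    (gcd a n + y * n) % n    ≡⟨ [m+kn]%n≡m%n (gcd a n) y n ⟩
    gcd a n % n              ∎)
  -- Here gcd a n ≡ -x·a, and -x ≡ x·(n-1) modulo n.
  ... | Bézout.-+ x y g+xa≡yn = x * pred n , (begin
    (x * pred n * a) % n             ≡⟨ [m+kn]%n≡m%n (x * pred n * a) y n ⟨
    (x * pred n * a + y * n) % n     ≡⟨ cong (_% n) shift ⟩
    (gcd a n + x * a * n) % n        ≡⟨ [m+kn]%n≡m%n (gcd a n) (x * a) n ⟩
    gcd a n % n                      ∎)
    where
    identity : ∀ x m a g → x * m * a + (g + x * a) ≡ g + x * a * suc m
    identity = solve-∀
    shift : x * pred n * a + y * n ≡ gcd a n + x * a * n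
    shift = begin
      x * pred n * a + y * n                 ≡⟨ cong (x * pred n * a +_) g+xa≡yn ⟨
      x * pred n * a + (gcd a n + x * a)     ≡⟨ identity x (pred n) a (gcd a n) ⟩
      gcd a n + x * a * suc (pred n)         ≡⟨ cong (λ m → gcd a n + x * a * m) (suc-pred n) ⟩
      gcd a n + x * a * n                    ∎

  multiple-*ˡ : ∀ e {c a r} → (c * a) % n ≡ r % n → (e * c * a) % n ≡ (e * r) % n
  multiple-*ˡ e {c} {a} {r} ca≡r = begin
    (e * c * a) % n                ≡⟨ cong (_% n) (*-assoc e c a) ⟩
    (e * (c * a)) % n              ≡⟨ %-distribˡ-* e (c * a) n ⟩
    ((e % n) * ((c * a) % n)) % n  ≡⟨ cong (λ t → ((e % n) * t) % n) ca≡r ⟩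
    ((e % n) * (r % n)) % n        ≡⟨ %-distribˡ-* e r n ⟨
    (e * r) % n                    ∎

  multiple-+n : ∀ c a → ((c + n) * a) % n ≡ (c * a) % n
  multiple-+n c a = begin
    ((c + n) * a) % n      ≡⟨ cong (_% n) (*-distribʳ-+ a c n) ⟩
    (c * a + n * a) % n    ≡⟨ cong (λ t → (c * a + t) % n) (*-comm n a) ⟩
    (c * a + a * n) % n    ≡⟨ [m+kn]%n≡m%n (c * a) a n ⟩
    (c * a) % n            ∎

  gcd∣⇒positive-multiple : ∀ {a b} → gcd a n ∣ b → ∃[ k ] (suc k * a) % n ≡ b % n
  gcd∣⇒positive-multiple {a} {b} (divides e b≡e*g) =
    let c , ca≡g = gcd-multiple a in
    e * c + pred n , (begin
      (suc (e * c + pred n) * a) % n  ≡⟨ cong (λ k → (k * a) % n) (suc[m+pred[n]]≡m+n (e * c)) ⟩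
      ((e * c + n) * a) % n           ≡⟨ multiple-+n (e * c) a ⟩
      (e * c * a) % n                 ≡⟨ multiple-*ˡ e ca≡g ⟩
      (e * gcd a n) % n               ≡⟨ cong (_% n) b≡e*g ⟨
      b % n                           ∎)
    where
    suc[m+pred[n]]≡m+n : ∀ m → suc (m + pred n) ≡ m + n
    suc[m+pred[n]]≡m+n m = trans (sym (+-suc m (pred n))) (cong (m +_) (suc-pred n))

-- Line graphs

record Obstruction (G : Graph) : Set where
  open Graph G
  field
    c₁ c₂ d₁ d₂ a b : Vertex
    c₁~c₂ : Adj c₁ c₂
    c₁~d₁ : Adj c₁ d₁
    c₁~d₂ : Adj c₁ d₂
    c₂~d₁ : Adj c₂ d₁
    c₂~d₂ : Adj c₂ d₂
    d₁~d₂ : Adj d₁ d₂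
    a~c₁  : Adj a c₁
    a~c₂  : Adj a c₂
    b~a   : Adj b a
    a≁d₁  : ¬ Adj a d₁
    b≁c₁  : ¬ Adj b c₁
    b≁c₂  : ¬ Adj b c₂
    a≢d₁  : a ≢ d₁
    b≢c₁  : b ≢ c₁
    b≢c₂  : b ≢ c₂

≅-obstruction : ∀ {G H} → G ≅ H → Obstruction G → Obstruction H
≅-obstruction {G} {H} G≅H o = record
  { c₁ = to c₁ ; c₂ = to c₂ ; d₁ = to d₁ ; d₂ = to d₂ ; a = to a ; b = to b
  ; c₁~c₂ = preserve c₁~c₂ ; c₁~d₁ = preserve c₁~d₁ ; c₁~d₂ = preserve c₁~d₂
  ; c₂~d₁ = preserve c₂~d₁ ; c₂~d₂ = preserve c₂~d₂ ; d₁~d₂ = preserve d₁~d₂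
  ; a~c₁ = preserve a~c₁ ; a~c₂ = preserve a~c₂ ; b~a = preserve b~a
  ; a≁d₁ = reflect a≁d₁ ; b≁c₁ = reflect b≁c₁ ; b≁c₂ = reflect b≁c₂
  ; a≢d₁ = a≢d₁ ∘ injective ; b≢c₁ = b≢c₁ ∘ injective ; b≢c₂ = b≢c₂ ∘ injective
  }
  where
  open Obstruction o
  open _≅_ G≅H
  open Inverse bij using (to; from; strictlyInverseʳ)

  preserve : ∀ {x y} → Graph.Adj G x y → Graph.Adj H (to x) (to y)
  preserve {x} {y} = Equivalence.to (adj-iff x y)

  reflect : ∀ {x y} → ¬ Graph.Adj G x y → ¬ Graph.Adj H (to x) (to y)
  reflect {x} {y} x≁y = x≁y ∘ Equivalence.from (adj-iff x y)

  injective : ∀ {x y} → to x ≡ to y → x ≡ y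
  injective {x} {y} tx≡ty = trans (sym (strictlyInverseʳ x)) (trans (cong from tx≡ty) (strictlyInverseʳ y))

module _ {m} {Γ : SimpleGraph m} where
  open Edge

  data _∋_ (e : Edge Γ) (z : Fin m) : Set where
    at-u : z ≡ u e → e ∋ z
    at-v : z ≡ v e → e ∋ z

  Meet : Edge Γ → Edge Γ → Set
  Meet e f = ∃[ z ] e ∋ z × f ∋ z

  Edge-≡ : ∀ {e f : Edge Γ} → u e ≡ u f → v e ≡ v f → e ≡ f
  Edge-≡ {edge _ _ _ _} {edge _ _ _ _} refl refl = refl

  lineAdj⇒meet : ∀ {e f} → LineAdj Γ e f → Meet e f
  lineAdj⇒meet {e} (_ , inj₁ u≡u)               = u e , at-u refl , at-u u≡u
  lineAdj⇒meet {e} (_ , inj₂ (inj₁ u≡v))        = u e , at-u refl , at-v u≡v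
  lineAdj⇒meet {e} (_ , inj₂ (inj₂ (inj₁ v≡u))) = v e , at-v refl , at-u v≡u
  lineAdj⇒meet {e} (_ , inj₂ (inj₂ (inj₂ v≡v))) = v e , at-v refl , at-v v≡v

  meet⇒lineAdj : ∀ {e f} → e ≢ f → Meet e f → LineAdj Γ e f
  meet⇒lineAdj e≢f (_ , at-u refl , at-u q) = e≢f , inj₁ q
  meet⇒lineAdj e≢f (_ , at-u refl , at-v q) = e≢f , inj₂ (inj₁ q)
  meet⇒lineAdj e≢f (_ , at-v refl , at-u q) = e≢f , inj₂ (inj₂ (inj₁ q))
  meet⇒lineAdj e≢f (_ , at-v refl , at-v q) = e≢f , inj₂ (inj₂ (inj₂ q))

  meet-sym : ∀ {e f} → Meet e f → Meet f e
  meet-sym (z , e∋z , f∋z) = z , f∋z , e∋z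

  u≢v : ∀ (e : Edge Γ) → u e ≢ v e
  u≢v (edge _ _ u<v _) u≡v = Irrelevant.⊥-elim (<-irrefl (cong toℕ u≡v) u<v)

  other-endpoint : ∀ {e z} → e ∋ z → ∃[ x ] e ∋ x × x ≢ z
  other-endpoint {e} (at-u refl) = v e , at-v refl , ≢-sym (u≢v e)
  other-endpoint {e} (at-v refl) = u e , at-u refl , u≢v e

  endpoints-only : ∀ {e x y z} → e ∋ x → e ∋ y → x ≢ y → e ∋ z → z ≡ x ⊎ z ≡ y
  endpoints-only (at-u refl) (at-u refl) x≢y _           = contradiction refl x≢y
  endpoints-only (at-u refl) (at-v refl) _   (at-u refl) = inj₁ refl
  endpoints-only (at-u refl) (at-v refl) _   (at-v refl) = inj₂ refl
  endpoints-only (at-v refl) (at-u refl) _   (at-u refl) = inj₂ refl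
  endpoints-only (at-v refl) (at-u refl) _   (at-v refl) = inj₁ refl
  endpoints-only (at-v refl) (at-v refl) x≢y _           = contradiction refl x≢y

  edge-determined : ∀ {e f x y} → x ≢ y → e ∋ x → e ∋ y → f ∋ x → f ∋ y → e ≡ f
  edge-determined x≢y (at-u refl) (at-u refl) _ _ = contradiction refl x≢y
  edge-determined x≢y (at-v refl) (at-v refl) _ _ = contradiction refl x≢y
  edge-determined x≢y _ _ (at-u p) (at-u q) = contradiction (trans p (sym q)) x≢y
  edge-determined x≢y _ _ (at-v p) (at-v q) = contradiction (trans p (sym q)) x≢y
  edge-determined _ (at-u refl) (at-v refl) (at-u p) (at-v q) = Edge-≡ p q
  edge-determined _ (at-v refl) (at-u refl) (at-v p) (at-u q) = Edge-≡ q p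
  edge-determined {edge _ _ e< _} {edge _ _ f< _} _ (at-u refl) (at-v refl) (at-v p) (at-u q) =
    Irrelevant.⊥-elim (<-asym e< (subst₂ (λ i j → toℕ i < toℕ j) (sym q) (sym p) f<))
  edge-determined {edge _ _ e< _} {edge _ _ f< _} _ (at-v refl) (at-u refl) (at-u p) (at-v q) =
    Irrelevant.⊥-elim (<-asym e< (subst₂ (λ i j → toℕ i < toℕ j) (sym p) (sym q) f<))

  _∋?_ : ∀ (e : Edge Γ) z → Dec (e ∋ z)
  e ∋? z = map′ [ at-u , at-v ] (λ { (at-u p) → inj₁ p ; (at-v p) → inj₂ p })
                (z Fin.≟ u e ⊎-dec z Fin.≟ v e)

  meets-at : ∀ {e f w x} → e ∋ w → e ∋ x → x ≢ w → ¬ f ∋ w → Meet e f → f ∋ x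
  meets-at e∋w e∋x x≢w f∌w (z , e∋z , f∋z) with endpoints-only e∋w e∋x (≢-sym x≢w) e∋z
  ... | inj₁ refl = contradiction f∋z f∌w
  ... | inj₂ refl = f∋z

  -- Four pairwise adjacent edges share an endpoint w (edges that pairwise meet without a
  -- common endpoint form a triangle, which has only three).  An edge meeting two of them but
  -- not a third avoids w, so it joins their far ends, and every edge meeting it meets one
  -- of those two.
  lineGraph-obstruction-free : ¬ Obstruction (LineGraph Γ)
  lineGraph-obstruction-free o with lineAdj⇒meet (Obstruction.c₁~c₂ o)
  ... | w , c₁∋w , c₂∋w with other-endpoint c₁∋w | other-endpoint c₂∋w
  ... | x₁ , c₁∋x₁ , x₁≢w | x₂ , c₂∋x₂ , x₂≢w = b-meets-neither (lineAdj⇒meet b~a)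
    where
    open Obstruction o

    x₁≢x₂ : x₁ ≢ x₂
    x₁≢x₂ refl = proj₁ c₁~c₂ (edge-determined (≢-sym x₁≢w) c₁∋w c₁∋x₁ c₂∋w c₂∋x₂)

    joins-far-ends : ∀ {f} → ¬ f ∋ w → Meet c₁ f → Meet c₂ f → f ∋ x₁ × f ∋ x₂
    joins-far-ends f∌w c₁⌢f c₂⌢f =
      meets-at c₁∋w c₁∋x₁ x₁≢w f∌w c₁⌢f , meets-at c₂∋w c₂∋x₂ x₂≢w f∌w c₂⌢f

    ¬¬d₁∋w : ¬ ¬ d₁ ∋ w
    ¬¬d₁∋w d₁∌w with joins-far-ends d₁∌w (lineAdj⇒meet c₁~d₁) (lineAdj⇒meet c₂~d₁) | d₂ ∋? w
    ... | d₁∋x₁ , d₁∋x₂ | no d₂∌w =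
      let d₂∋x₁ , d₂∋x₂ = joins-far-ends d₂∌w (lineAdj⇒meet c₁~d₂) (lineAdj⇒meet c₂~d₂)
      in proj₁ d₁~d₂ (edge-determined x₁≢x₂ d₁∋x₁ d₁∋x₂ d₂∋x₁ d₂∋x₂)
    ... | d₁∋x₁ , d₁∋x₂ | yes d₂∋w with lineAdj⇒meet d₁~d₂
    ... | z , d₁∋z , d₂∋z with endpoints-only d₁∋x₁ d₁∋x₂ x₁≢x₂ d₁∋z
    ... | inj₁ refl = proj₁ c₁~d₂ (edge-determined (≢-sym x₁≢w) c₁∋w c₁∋x₁ d₂∋w d₂∋z)
    ... | inj₂ refl = proj₁ c₂~d₂ (edge-determined (≢-sym x₂≢w) c₂∋w c₂∋x₂ d₂∋w d₂∋z)

    a∌w : ¬ a ∋ w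
    a∌w a∋w = a≁d₁ (meet⇒lineAdj a≢d₁ (w , a∋w , decidable-stable (d₁ ∋? w) ¬¬d₁∋w))

    b-meets-neither : ¬ Meet b a
    b-meets-neither (z , b∋z , a∋z)
      with joins-far-ends a∌w (meet-sym (lineAdj⇒meet a~c₁)) (meet-sym (lineAdj⇒meet a~c₂))
    ... | a∋x₁ , a∋x₂ with endpoints-only a∋x₁ a∋x₂ x₁≢x₂ a∋z
    ... | inj₁ refl = b≁c₁ (meet⇒lineAdj b≢c₁ (z , b∋z , c₁∋x₁))
    ... | inj₂ refl = b≁c₂ (meet⇒lineAdj b≢c₂ (z , b∋z , c₂∋x₂))

-- Power graphs of cyclic groups

module CyclicGroup (n : ℕ) .{{_ : NonZero n}} where

  -- ⟨x⟩ is the subgroup of index gcd x n, so y is a power of x iff index x ∣ index y.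
  index : Fin n → ℕ
  index x = gcd (toℕ x) n

  power⇔index∣ : ∀ {x y} → (∃[ k ] pow n (suc k) x ≡ toℕ y) ⇔ index x ∣ index y
  power⇔index∣ {x} {y} = mk⇔ to from
    where
    index∣n : index x ∣ n
    index∣n = gcd[m,n]∣n (toℕ x) n

    to : ∃[ k ] pow n (suc k) x ≡ toℕ y → index x ∣ index y
    to (k , xᵏ≡y) = gcd-greatest
      (subst (index x ∣_) xᵏ≡y (%-presˡ-∣ (∣n⇒∣m*n (suc k) (gcd[m,n]∣m (toℕ x) n)) index∣n))
      index∣n

    from : index x ∣ index y → ∃[ k ] pow n (suc k) x ≡ toℕ y
    from ix∣iy =
      let k , xᵏ≡y = gcd∣⇒positive-multiple n {toℕ x} (∣-trans ix∣iy (gcd[m,n]∣m (toℕ y) n))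
      in k , trans xᵏ≡y (m<n⇒m%n≡m (toℕ<n y))

  powAdj⇔ : ∀ {x y} → PowAdj n x y ⇔ (x ≢ y × Comparable (index x) (index y))
  powAdj⇔ = mk⇔ (Product.map₂ (Sum.map to to)) (Product.map₂ (Sum.map from from))
    where
    open module P {x} {y} = Equivalence (power⇔index∣ {x} {y})

  comparable⇒dominating : ∀ {x} → (∀ y → Comparable (index x) (index y)) → Dominating n x
  comparable⇒dominating x~ y y≢x = Equivalence.from powAdj⇔ (≢-sym y≢x , x~ y)

  incomparable⇒¬dominating : ∀ {x} y → ¬ Comparable (index x) (index y) → ¬ Dominating n x
  incomparable⇒¬dominating {x} y x≁y x-dom = x≁y (proj₂ (Equivalence.to powAdj⇔ (x-dom y y≢x)))
    where
    y≢x : y ≢ x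
    y≢x refl = x≁y (inj₁ ∣-refl)

  identity-dominating : ∀ {x} → toℕ x ≡ 0 → Dominating n x
  identity-dominating {x} x≡0 = comparable⇒dominating λ y →
    inj₂ (gcd-greatest (subst (index y ∣_) (sym x≡0) (index y ∣0)) (gcd[m,n]∣n (toℕ y) n))

  generator-dominating : ∀ {x} → index x ≡ 1 → Dominating n x
  generator-dominating {x} ix≡1 = comparable⇒dominating λ y → inj₁ (subst (_∣ index y) (sym ix≡1) (1∣ index y))

  adjacent : ∀ {x y g h} → index x ≡ g → index y ≡ h → x ≢ y → Comparable g h → PowAdj n x y
  adjacent refl refl x≢y g~h = Equivalence.from powAdj⇔ (x≢y , g~h)

  nonadjacent : ∀ {x y g h} → index x ≡ g → index y ≡ h → ¬ Comparable g h → ¬ PowAdj n x y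
  nonadjacent refl refl g≁h = g≁h ∘ proj₂ ∘ Equivalence.to powAdj⇔

  distinct : ∀ {x y g h} → index x ≡ g → index y ≡ h → g ≢ h → x ≢ y
  distinct refl refl g≢h refl = g≢h refl

  module _ {g k : ℕ} (n≡g*k : n ≡ g * k) where

    private instance
      g≢0 : NonZero g
      g≢0 = ≢-nonZero λ { refl → ≢-nonZero⁻¹ n n≡g*k }

    g∣n : g ∣ n
    g∣n = divides k (trans n≡g*k (*-comm g k))

    g<n : 1 < k → g < n
    g<n 1<k = subst (g <_) (sym n≡g*k) (m<m*n g k 1<k)

    element-of-index : 1 < k → ∃[ x ] index x ≡ g
    element-of-index 1<k =
      fromℕ< (g<n 1<k) , trans (cong (λ t → gcd t n) (toℕ-fromℕ< (g<n 1<k))) (gcd[d,n]≡d g∣n)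

    two-elements-of-index : 2 < k → ∃[ x ] ∃[ y ] x ≢ y × index x ≡ g × index y ≡ g
    two-elements-of-index 2<k = x , y , x≢y , ix≡g , iy≡g
      where
      g<n′ : g < n
      g<n′ = g<n (<-trans (s≤s (s≤s z≤n)) 2<k)
      n∸g<n : n ∸ g < n
      n∸g<n = ∸-monoʳ-< (>-nonZero⁻¹ g) (<⇒≤ g<n′)
      x y : Fin n
      x = fromℕ< g<n′
      y = fromℕ< n∸g<n
      n∸g≡g*[k∸1] : n ∸ g ≡ g * (k ∸ 1)
      n∸g≡g*[k∸1] = begin
        n ∸ g          ≡⟨ cong (_∸ g) n≡g*k ⟩
        g * k ∸ g      ≡⟨ cong (g * k ∸_) (*-identityʳ g) ⟨
        g * k ∸ g * 1  ≡⟨ *-distribˡ-∸ g k 1 ⟨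
        g * (k ∸ 1)    ∎
        where open ≡-Reasoning
      x≢y : x ≢ y
      x≢y x≡y = <⇒≢ (m<m*n g (k ∸ 1) (∸-monoˡ-< 2<k (s≤s z≤n)))
        (trans (sym (toℕ-fromℕ< g<n′)) (trans (cong toℕ x≡y) (trans (toℕ-fromℕ< n∸g<n) n∸g≡g*[k∸1])))
      ix≡g : index x ≡ g
      ix≡g = trans (cong (λ t → gcd t n) (toℕ-fromℕ< g<n′)) (gcd[d,n]≡d g∣n)
      iy≡g : index y ≡ g
      iy≡g = trans (cong (λ t → gcd t n) (toℕ-fromℕ< n∸g<n)) (gcd[n∸d,n]≡d g∣n (∣⇒≤ g∣n))

  obstruction : ∀ {c d a b kc kd ka kb} →
    n ≡ c * kc → 2 < kc → n ≡ d * kd → 2 < kd → n ≡ a * ka → 1 < ka → n ≡ b * kb → 1 < kb →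
    StrictlyComparable c d → StrictlyComparable c a → StrictlyComparable b a →
    ¬ Comparable a d → ¬ Comparable b c → Obstruction (ProperPowerGraph n)
  obstruction n≡c*kc 2<kc n≡d*kd 2<kd n≡a*ka 1<ka n≡b*kb 1<kb
              (c≢d , c~d) (c≢a , c~a) (b≢a , b~a) a≁d b≁c
    with two-elements-of-index n≡c*kc 2<kc | two-elements-of-index n≡d*kd 2<kd
       | element-of-index n≡a*ka 1<ka | element-of-index n≡b*kb 1<kb
  ... | c₁ , c₂ , c₁≢c₂ , ic₁ , ic₂ | d₁ , d₂ , d₁≢d₂ , id₁ , id₂ | a , ia | b , ib = record
    { c₁ = vertex c₁ ic₁ b ib (b≁c ∘ swap)
    ; c₂ = vertex c₂ ic₂ b ib (b≁c ∘ swap)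
    ; d₁ = vertex d₁ id₁ a ia (a≁d ∘ swap)
    ; d₂ = vertex d₂ id₂ a ia (a≁d ∘ swap)
    ; a  = vertex a ia d₁ id₁ a≁d
    ; b  = vertex b ib c₁ ic₁ b≁c
    ; c₁~c₂ = adjacent ic₁ ic₂ c₁≢c₂ (inj₁ ∣-refl)
    ; c₁~d₁ = adjacent ic₁ id₁ (distinct ic₁ id₁ c≢d) c~d
    ; c₁~d₂ = adjacent ic₁ id₂ (distinct ic₁ id₂ c≢d) c~d
    ; c₂~d₁ = adjacent ic₂ id₁ (distinct ic₂ id₁ c≢d) c~d
    ; c₂~d₂ = adjacent ic₂ id₂ (distinct ic₂ id₂ c≢d) c~d
    ; d₁~d₂ = adjacent id₁ id₂ d₁≢d₂ (inj₁ ∣-refl)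
    ; a~c₁  = adjacent ia ic₁ (distinct ia ic₁ (≢-sym c≢a)) (swap c~a)
    ; a~c₂  = adjacent ia ic₂ (distinct ia ic₂ (≢-sym c≢a)) (swap c~a)
    ; b~a   = adjacent ib ia (distinct ib ia b≢a) b~a
    ; a≁d₁  = nonadjacent ia id₁ a≁d
    ; b≁c₁  = nonadjacent ib ic₁ b≁c
    ; b≁c₂  = nonadjacent ib ic₂ b≁c
    ; a≢d₁  = distinct ia id₁ (incomparable⇒≢ a≁d) ∘ cong NonDom.elem
    ; b≢c₁  = distinct ib ic₁ (incomparable⇒≢ b≁c) ∘ cong NonDom.elem
    ; b≢c₂  = distinct ib ic₂ (incomparable⇒≢ b≁c) ∘ cong NonDom.elem
    }
    where
    vertex : ∀ {g h} (x : Fin n) → index x ≡ g → (y : Fin n) → index y ≡ h → ¬ Comparable g h → NonDom n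
    vertex x ix≡g y iy≡h g≁h =
      nondom x (incomparable⇒¬dominating y (subst₂ (λ g h → ¬ Comparable g h) (sym ix≡g) (sym iy≡h) g≁h))

  -- c, d, a and b are the indices of subgroups of orders pq, q, p and px.
  obstruction-pqx : ∀ {p q x m} .{{_ : NonZero m}} → Prime p → Prime q → Prime x →
    p ≢ q → x ≢ q → 2 < q → n ≡ p * q * x * m → Obstruction (ProperPowerGraph n)
  obstruction-pqx {p} {q} {x} {m} pp pq px p≢q x≢q 2<q n≡pqxm =
    obstruction
      (trans n≡pqxm (reorderᶜ p q x m)) (<-≤-trans 2<q (m≤n*m q p))
      (trans n≡pqxm (reorderᵈ p q x m)) 2<q
      (trans n≡pqxm (reorderᵃ p q x m)) (prime>1 pp)
      (trans n≡pqxm (reorderᵇ p q x m)) (<-≤-trans (prime>1 pp) (m≤n*m p x))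
      (strictlyComparable-* (m * x) (prime>1 pp) refl)
      (strictlyComparable-* (m * x) (prime>1 pq) refl)
      (strictlyComparable-* (m * q) (prime>1 px) (reorderᵃᵇ m q x))
      (incomparable-*ˡ (m * x) (primes-incomparable pq pp (≢-sym p≢q)))
      (incomparable-*ˡ m (primes-incomparable pq px (≢-sym x≢q)))
    where
    instance
      p≢0 : NonZero p
      p≢0 = prime⇒nonZero pp
      x≢0 : NonZero x
      x≢0 = prime⇒nonZero px
      mx≢0 : NonZero (m * x)
      mx≢0 = m*n≢0 m x
      q≢0 : NonZero q
      q≢0 = prime⇒nonZero pq
      mq≢0 : NonZero (m * q)
      mq≢0 = m*n≢0 m q
    reorderᶜ : ∀ p q x m → p * q * x * m ≡ m * x * (p * q)
    reorderᶜ = solve-∀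
    reorderᵈ : ∀ p q x m → p * q * x * m ≡ m * x * p * q
    reorderᵈ = solve-∀
    reorderᵃ : ∀ p q x m → p * q * x * m ≡ m * x * q * p
    reorderᵃ = solve-∀
    reorderᵇ : ∀ p q x m → p * q * x * m ≡ m * q * (x * p)
    reorderᵇ = solve-∀
    reorderᵃᵇ : ∀ m q x → m * x * q ≡ m * q * x
    reorderᵃᵇ = solve-∀

  -- c, d, a and b are the indices of subgroups of orders p, p², pq and q.
  obstruction-ppq : ∀ {p q m} .{{_ : NonZero m}} → Prime p → Prime q →
    p ≢ q → 2 < p → n ≡ p * p * q * m → Obstruction (ProperPowerGraph n)
  obstruction-ppq {p} {q} {m} pp pq p≢q 2<p n≡ppqm =
    obstruction
      (trans n≡ppqm (reorderᶜ p q m)) 2<p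
      (trans n≡ppqm (reorderᵈ p q m)) (<-≤-trans 2<p (m≤n*m p p))
      (trans n≡ppqm (reorderᵃ p q m)) (<-≤-trans (prime>1 pp) (m≤m*n p q))
      (trans n≡ppqm (reorderᵇ p q m)) (prime>1 pq)
      (strictlyComparable-sym (strictlyComparable-* (m * q) (prime>1 pp) (reorderᶜᵈ m p q)))
      (strictlyComparable-sym (strictlyComparable-* (m * p) (prime>1 pq) refl))
      (strictlyComparable-sym (strictlyComparable-* (m * p) (prime>1 pp) refl))
      (incomparable-*ˡ m (primes-incomparable pp pq p≢q))
      (incomparable-*ˡ (m * p) (primes-incomparable pp pq p≢q))
    where
    instance
      p≢0 : NonZero p
      p≢0 = prime⇒nonZero pp
      q≢0 : NonZero q
      q≢0 = prime⇒nonZero pq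
      mp≢0 : NonZero (m * p)
      mp≢0 = m*n≢0 m p
      mq≢0 : NonZero (m * q)
      mq≢0 = m*n≢0 m q
    reorderᶜ : ∀ p q m → p * p * q * m ≡ m * p * q * p
    reorderᶜ = solve-∀
    reorderᵈ : ∀ p q m → p * p * q * m ≡ m * q * (p * p)
    reorderᵈ = solve-∀
    reorderᵃ : ∀ p q m → p * p * q * m ≡ m * p * (p * q)
    reorderᵃ = solve-∀
    reorderᵇ : ∀ p q m → p * p * q * m ≡ m * p * p * q
    reorderᵇ = solve-∀
    reorderᶜᵈ : ∀ m p q → m * p * q ≡ m * q * p
    reorderᶜᵈ = solve-∀

  obstruction-p²q : ∀ {p q m} .{{_ : NonZero m}} → Prime p → Prime q → p ≢ q →
    n ≡ p * p * q * m → Obstruction (ProperPowerGraph n)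
  obstruction-p²q {p} {q} {m} pp pq p≢q n≡ppqm with q ≟ 2
  ... | no q≢2   = obstruction-pqx pp pq pp p≢q p≢q (prime≢2⇒prime>2 pq q≢2) (trans n≡ppqm (reorder p q m))
    where
    reorder : ∀ p q m → p * p * q * m ≡ p * q * p * m
    reorder = solve-∀
  ... | yes refl = obstruction-ppq pp pq p≢q (prime≢2⇒prime>2 pp p≢q) n≡ppqm

  obstruction-pqr : ∀ {p q r m} .{{_ : NonZero m}} → Prime p → Prime q → Prime r →
    p ≢ q → p ≢ r → q ≢ r → n ≡ p * q * r * m → Obstruction (ProperPowerGraph n)
  obstruction-pqr {p} {q} {r} {m} pp pq pr p≢q p≢r q≢r n≡pqrm with q ≟ 2
  ... | no q≢2   = obstruction-pqx pp pq pr p≢q (≢-sym q≢r) (prime≢2⇒prime>2 pq q≢2) n≡pqrm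
  ... | yes refl = obstruction-pqx pq pp pr (≢-sym p≢q) (≢-sym p≢r) (prime≢2⇒prime>2 pp p≢q)
                     (trans n≡pqrm (reorder p q r m))
    where
    reorder : ∀ p q r m → p * q * r * m ≡ q * p * r * m
    reorder = solve-∀

-- Prime factorisation patterns

IsPrimePower : ℕ → Set
IsPrimePower n = ∃[ p ] ∃[ t ] (Prime p × 1 ≤ t × n ≡ p ^ t)

IsProductOfTwoPrimes : ℕ → Set
IsProductOfTwoPrimes n = ∃[ p ] ∃[ q ] (Prime p × Prime q × p ≢ q × n ≡ p * q)

data Shape (n : ℕ) : Set where
  prime-power        : IsPrimePower n → Shape n
  product-of-two     : IsProductOfTwoPrimes n → Shape n
  multiple-of-p²q    : ∀ {p q m} .{{_ : NonZero m}} → Prime p → Prime q → p ≢ q →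
                       n ≡ p * p * q * m → Shape n
  multiple-of-pqr    : ∀ {p q r m} .{{_ : NonZero m}} → Prime p → Prime q → Prime r →
                       p ≢ q → p ≢ r → q ≢ r → n ≡ p * q * r * m → Shape n

copies-or-other : ∀ p ps → All Prime ps →
  All (_≡ p) ps ⊎ ∃[ q ] ∃[ qs ] (Prime q × q ≢ p × All Prime qs × product ps ≡ q * product qs)
copies-or-other p [] [] = inj₁ []
copies-or-other p (r ∷ rs) (pr ∷ prs) with r ≟ p | copies-or-other p rs prs
... | no r≢p   | _ = inj₂ (r , rs , pr , r≢p , prs , refl)
... | yes r≡p  | inj₁ rs≡p = inj₁ (r≡p ∷ rs≡p)
... | yes _    | inj₂ (q , qs , pq , q≢p , pqs , Πrs≡q*Πqs) =
  inj₂ (q , r ∷ qs , pq , q≢p , pr ∷ pqs , trans (cong (r *_) Πrs≡q*Πqs) (x∙yz≈y∙xz r q (product qs)))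

product-copies : ∀ {p} ps → All (_≡ p) ps → product ps ≡ p ^ length ps
product-copies []       []          = refl
product-copies (r ∷ rs) (refl ∷ rs≡p) = cong (r *_) (product-copies rs rs≡p)

shape : ∀ n .{{_ : NonZero n}} → 2 ≤ n → Shape n
shape n 2≤n with factorise n
... | record { factors = [] ; isFactorisation = n≡1 } = contradiction n≡1 (>⇒≢ 2≤n)
... | record { factors = p ∷ ps ; isFactorisation = n≡p*Πps ; factorsPrime = pp ∷ pps }
  with copies-or-other p ps pps
... | inj₁ ps≡p =
  prime-power (p , suc (length ps) , pp , s≤s z≤n , trans n≡p*Πps (cong (p *_) (product-copies ps ps≡p)))
... | inj₂ (q , [] , pq , q≢p , [] , Πps≡q*1) =
  product-of-two (p , q , pp , pq , ≢-sym q≢p , trans n≡p*Πps (cong (p *_) (trans Πps≡q*1 (*-identityʳ q))))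
... | inj₂ (q , r ∷ rs , pq , q≢p , pr ∷ prs , Πps≡q*r*Πrs) with r ≟ p | r ≟ q
...   | yes refl | _ = multiple-of-p²q {{productOfPrimes≢0 prs}} pp pq (≢-sym q≢p)
  (trans n≡p*Πps (trans (cong (p *_) Πps≡q*r*Πrs) (reorder p q (product rs))))
  where
  reorder : ∀ p q m → p * (q * (p * m)) ≡ p * p * q * m
  reorder = solve-∀
...   | no _ | yes refl = multiple-of-p²q {{productOfPrimes≢0 prs}} pq pp q≢p
  (trans n≡p*Πps (trans (cong (p *_) Πps≡q*r*Πrs) (reorder p q (product rs))))
  where
  reorder : ∀ p q m → p * (q * (q * m)) ≡ q * q * p * m
  reorder = solve-∀
...   | no r≢p | no r≢q = multiple-of-pqr {{productOfPrimes≢0 prs}} pp pq pr (≢-sym q≢p) (≢-sym r≢p) (≢-sym r≢q)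
  (trans n≡p*Πps (trans (cong (p *_) Πps≡q*r*Πrs) (reorder p q r (product rs))))
  where
  reorder : ∀ p q r m → p * (q * (r * m)) ≡ p * q * r * m
  reorder = solve-∀

-- The prime-power and two-prime cases

≅-empty : ∀ {G H} → ¬ Graph.Vertex G → ¬ Graph.Vertex H → G ≅ H
≅-empty ¬G ¬H = record
  { bij     = mk↔ₛ′ (⊥-elim ∘ ¬G) (⊥-elim ∘ ¬H) (⊥-elim ∘ ¬H) (⊥-elim ∘ ¬G)
  ; adj-iff = λ x → ⊥-elim (¬G x)
  }

edgeless : SimpleGraph 0
edgeless = record { Adj = λ _ _ → ⊥ ; symm = λ () ; irrefl = λ () }

prime-power-dominating : ∀ {p} t .{{_ : NonZero (p ^ t)}} → Prime p → ∀ x → Dominating (p ^ t) x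
prime-power-dominating {p} t pp x = comparable⇒dominating λ y →
  prime-power-divisors-comparable pp t (gcd[m,n]∣n (toℕ x) (p ^ t)) (gcd[m,n]∣n (toℕ y) (p ^ t))
  where open CyclicGroup (p ^ t)

prime-power≅lineGraph : ∀ {p} t .{{_ : NonZero (p ^ t)}} → Prime p → ProperPowerGraph (p ^ t) ≅ LineGraph edgeless
prime-power≅lineGraph t pp = ≅-empty
  (λ { (nondom x x-nondom) → Irrelevant.⊥-elim (x-nondom (prime-power-dominating t pp x)) })
  (λ { (edge () _ _ _) })

module ProductOfTwoPrimes {p q : ℕ} .{{_ : NonZero (p * q)}} (pp : Prime p) (pq : Prime q) (p≢q : p ≢ q) where
  open CyclicGroup (p * q)
  private
    instance
      p≢0 : NonZero p
      p≢0 = prime⇒nonZero pp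
      q≢0 : NonZero q
      q≢0 = prime⇒nonZero pq

  data Leaf (x : Fin (p * q)) : Set where
    p-leaf : p ∣ toℕ x → toℕ x ≢ 0 → Leaf x
    q-leaf : q ∣ toℕ x → ¬ p ∣ toℕ x → Leaf x

  leaf-prime : ∀ {x} → Leaf x → ℕ
  leaf-prime (p-leaf _ _) = p
  leaf-prime (q-leaf _ _) = q

  index-leaf : ∀ {x} (l : Leaf x) → index x ≡ leaf-prime l
  index-leaf {x} (p-leaf p∣x x≢0) =
    ∣-antisym (gcd[x,a*b]∣a pq q∤x) (gcd-greatest p∣x (m∣m*n q))
    where
    q∤x : ¬ q ∣ toℕ x
    q∤x q∣x = x≢0 (∣∧<⇒≡0 (distinct-primes-∣⇒∣* pp pq p≢q p∣x q∣x) (toℕ<n x))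
  index-leaf {x} (q-leaf q∣x p∤x) =
    ∣-antisym (subst (λ n → gcd (toℕ x) n ∣ q) (*-comm q p) (gcd[x,a*b]∣a pp p∤x)) (gcd-greatest q∣x (n∣m*n p))

  index-nonleaf : ∀ {x} → ¬ p ∣ toℕ x → ¬ q ∣ toℕ x → index x ≡ 1
  index-nonleaf {x} p∤x q∤x with prime⇒irreducible pp (gcd[x,a*b]∣a pq q∤x)
  ... | inj₁ ix≡1 = ix≡1
  ... | inj₂ ix≡p = contradiction (subst (_∣ toℕ x) ix≡p (gcd[m,n]∣m (toℕ x) (p * q))) p∤x

  leaf : ∀ x → .(¬ Dominating (p * q) x) → Leaf x
  leaf x x-nondom with toℕ x ≟ 0 | p ∣? toℕ x | q ∣? toℕ x
  ... | yes x≡0 | _       | _       = Irrelevant.⊥-elim (x-nondom (identity-dominating x≡0))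
  ... | no x≢0  | yes p∣x | _       = p-leaf p∣x x≢0
  ... | no _    | no p∤x  | yes q∣x = q-leaf q∣x p∤x
  ... | no _    | no p∤x  | no q∤x  = Irrelevant.⊥-elim (x-nondom (generator-dominating (index-nonleaf p∤x q∤x)))

  leaf⇒¬dominating : ∀ {x} → Leaf x → ¬ Dominating (p * q) x
  leaf⇒¬dominating l@(p-leaf _ _) =
    let y , iy≡q = element-of-index (*-comm p q) (prime>1 pp)
    in incomparable⇒¬dominating y
         (subst₂ (λ g h → ¬ Comparable g h) (sym (index-leaf l)) (sym iy≡q) (primes-incomparable pp pq p≢q))
  leaf⇒¬dominating l@(q-leaf _ _) =
    let y , iy≡p = element-of-index refl (prime>1 pq)
    in incomparable⇒¬dominating y
         (subst₂ (λ g h → ¬ Comparable g h) (sym (index-leaf l)) (sym iy≡p) (primes-incomparable pq pp (≢-sym p≢q)))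

  leaf≥2 : ∀ {x} → Leaf x → 2 ≤ toℕ x
  leaf≥2 {x} (p-leaf p∣x x≢0) = ≤-trans (prime>1 pp) (∣⇒≤ {{≢-nonZero x≢0}} p∣x)
  leaf≥2 {x} (q-leaf q∣x p∤x) = ≤-trans (prime>1 pq) (∣⇒≤ {{≢-nonZero x≢0}} q∣x)
    where
    x≢0 : toℕ x ≢ 0
    x≢0 x≡0 = p∤x (subst (p ∣_) (sym x≡0) (p ∣0))

  1<pq : 1 < p * q
  1<pq = <-≤-trans (prime>1 pp) (m≤m*n p q)

  0<pq : 0 < p * q
  0<pq = <-trans (s≤s z≤n) 1<pq

  -- Γ is a star at 0 whose leaves are the nonzero multiples of p, together with a star at 1
  -- whose leaves are the other nonzero multiples of q; the leaf x stands for the edge {hub, x}.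
  hub : ∀ {x} → Leaf x → Fin (p * q)
  hub (p-leaf _ _) = fromℕ< 0<pq
  hub (q-leaf _ _) = fromℕ< 1<pq

  hub≤1 : ∀ {x} (l : Leaf x) → toℕ (hub l) ≤ 1
  hub≤1 (p-leaf _ _) = subst (_≤ 1) (sym (toℕ-fromℕ< 0<pq)) z≤n
  hub≤1 (q-leaf _ _) = subst (_≤ 1) (sym (toℕ-fromℕ< 1<pq)) ≤-refl

  hub<leaf : ∀ {x y} (l : Leaf x) → Leaf y → toℕ (hub l) < toℕ y
  hub<leaf l l′ = ≤-trans (s≤s (hub≤1 l)) (leaf≥2 l′)

  hub≢leaf : ∀ {x y} (l : Leaf x) → Leaf y → hub l ≢ y
  hub≢leaf l l′ = <⇒≢ (hub<leaf l l′) ∘ cong toℕ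

  hub-unique : ∀ {x} (l l′ : Leaf x) → hub l ≡ hub l′
  hub-unique (p-leaf _ _)   (p-leaf _ _)   = refl
  hub-unique (q-leaf _ _)   (q-leaf _ _)   = refl
  hub-unique (p-leaf p∣x _) (q-leaf _ p∤x) = contradiction p∣x p∤x
  hub-unique (q-leaf _ p∤x) (p-leaf p∣x _) = contradiction p∣x p∤x

  sameHub⇔comparable : ∀ {x y} (l : Leaf x) (l′ : Leaf y) →
    Comparable (leaf-prime l) (leaf-prime l′) ⇔ hub l ≡ hub l′
  sameHub⇔comparable (p-leaf _ _) (p-leaf _ _) = mk⇔ (λ _ → refl) (λ _ → inj₁ ∣-refl)
  sameHub⇔comparable (q-leaf _ _) (q-leaf _ _) = mk⇔ (λ _ → refl) (λ _ → inj₁ ∣-refl)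
  sameHub⇔comparable (p-leaf _ _) (q-leaf _ _) =
    mk⇔ (⊥-elim ∘ primes-incomparable pp pq p≢q) (⊥-elim ∘ 0≢1 ∘ cong toℕ)
    where
    0≢1 : toℕ (fromℕ< 0<pq) ≢ toℕ (fromℕ< 1<pq)
    0≢1 0≡1 = 0≢1+n (trans (sym (toℕ-fromℕ< 0<pq)) (trans 0≡1 (toℕ-fromℕ< 1<pq)))
  sameHub⇔comparable (q-leaf _ _) (p-leaf _ _) =
    mk⇔ (⊥-elim ∘ primes-incomparable pq pp (≢-sym p≢q)) (⊥-elim ∘ 1≢0 ∘ cong toℕ)
    where
    1≢0 : toℕ (fromℕ< 1<pq) ≢ toℕ (fromℕ< 0<pq)
    1≢0 1≡0 = 0≢1+n (trans (sym (toℕ-fromℕ< 0<pq)) (trans (sym 1≡0) (toℕ-fromℕ< 1<pq)))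

  HubOf : Fin (p * q) → Fin (p * q) → Set
  HubOf h x = Σ (Leaf x) λ l → hub l ≡ h

  Γ : SimpleGraph (p * q)
  Γ = record { Adj = λ u v → HubOf u v ⊎ HubOf v u ; symm = swap ; irrefl = [ no-loop , no-loop ] }
    where
    no-loop : ∀ {x} → ¬ HubOf x x
    no-loop (l , hub≡x) = hub≢leaf l l hub≡x

  leaf-edge : ∀ {x} → Leaf x → Edge Γ
  leaf-edge {x} l = edge (hub l) x (hub<leaf l l) (inj₁ (l , refl))

  hub-below : ∀ {u v} → HubOf v u → ¬ toℕ u < toℕ v
  hub-below (l , hub≡v) u<v = <-asym u<v (subst (λ v → toℕ v < toℕ _) hub≡v (hub<leaf l l))

  upper-leaf : ∀ {u v} → SimpleGraph.Adj Γ u v → toℕ u < toℕ v → Leaf v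
  upper-leaf (inj₁ (l , _)) _   = l
  upper-leaf (inj₂ v-hub) u<v = ⊥-elim (hub-below v-hub u<v)

  upper-hub : ∀ {u v} → SimpleGraph.Adj Γ u v → toℕ u < toℕ v → (l : Leaf v) → hub l ≡ u
  upper-hub (inj₁ (l′ , hub≡u)) _ l = trans (hub-unique l l′) hub≡u
  upper-hub (inj₂ v-hub) u<v _ = ⊥-elim (hub-below v-hub u<v)

  toEdge : NonDom (p * q) → Edge Γ
  toEdge (nondom x x-nondom) = leaf-edge (leaf x x-nondom)

  fromEdge : Edge Γ → NonDom (p * q)
  fromEdge (edge u v u<v u~v) = nondom v (leaf⇒¬dominating (upper-leaf u~v u<v))

  leaf-edge-upper : ∀ {u v} (l : Leaf v) .(u<v : toℕ u < toℕ v) .(u~v : SimpleGraph.Adj Γ u v) →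
    leaf-edge l ≡ edge u v u<v u~v
  leaf-edge-upper {u} l u<v u~v with hub l Fin.≟ u
  ... | yes hub≡u = Edge-≡ hub≡u refl
  ... | no hub≢u  = Irrelevant.⊥-elim (hub≢u (upper-hub u~v u<v l))

  toEdge∘fromEdge : ∀ e → toEdge (fromEdge e) ≡ e
  toEdge∘fromEdge (edge u v u<v u~v) = leaf-edge-upper (leaf v (leaf⇒¬dominating (upper-leaf u~v u<v))) u<v u~v

  fromEdge∘toEdge : ∀ x → fromEdge (toEdge x) ≡ x
  fromEdge∘toEdge (nondom _ _) = refl

  powAdj⇔sameHub : ∀ {x y} (l : Leaf x) (l′ : Leaf y) → PowAdj (p * q) x y ⇔ (x ≢ y × hub l ≡ hub l′)
  powAdj⇔sameHub l l′ = mk⇔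
    (λ x~y → let x≢y , ix~iy = Equivalence.to powAdj⇔ x~y in
      x≢y , Equivalence.to (sameHub⇔comparable l l′) (subst₂ Comparable (index-leaf l) (index-leaf l′) ix~iy))
    (λ (x≢y , same-hub) → adjacent (index-leaf l) (index-leaf l′) x≢y (Equivalence.from (sameHub⇔comparable l l′) same-hub))

  lineAdj⇔sameHub : ∀ {x y} (l : Leaf x) (l′ : Leaf y) →
    LineAdj Γ (leaf-edge l) (leaf-edge l′) ⇔ (x ≢ y × hub l ≡ hub l′)
  lineAdj⇔sameHub {x} {y} l l′ = mk⇔ to (λ (x≢y , same-hub) → x≢y ∘ cong Edge.v , inj₁ same-hub)
    where
    to : LineAdj Γ (leaf-edge l) (leaf-edge l′) → x ≢ y × hub l ≡ hub l′
    to (e≢e′ , meet) = x≢y , same-hub meet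
      where
      x≢y : x ≢ y
      x≢y refl = e≢e′ (Edge-≡ (hub-unique l l′) refl)
      same-hub : _ → hub l ≡ hub l′
      same-hub (inj₁ hub≡hub)               = hub≡hub
      same-hub (inj₂ (inj₁ hub≡y))          = contradiction hub≡y (hub≢leaf l l′)
      same-hub (inj₂ (inj₂ (inj₁ x≡hub)))   = contradiction (sym x≡hub) (hub≢leaf l′ l)
      same-hub (inj₂ (inj₂ (inj₂ x≡y)))     = contradiction x≡y x≢y

  properPowerGraph≅lineGraph : ProperPowerGraph (p * q) ≅ LineGraph Γ
  properPowerGraph≅lineGraph = record
    { bij     = mk↔ₛ′ toEdge fromEdge toEdge∘fromEdge fromEdge∘toEdge
    ; adj-iff = λ { (nondom x x-nondom) (nondom y y-nondom) →
        let l = leaf x x-nondom ; l′ = leaf y y-nondom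
        in ⇔-sym (lineAdj⇔sameHub l l′) ⇔-∘ powAdj⇔sameHub l l′ }
    }

lineGraph⇒primePower⊎productOfTwoPrimes : ∀ {n m} .{{_ : NonZero n}} {Γ : SimpleGraph m} →
  ProperPowerGraph n ≅ LineGraph Γ → 2 ≤ n → IsPrimePower n ⊎ IsProductOfTwoPrimes n
lineGraph⇒primePower⊎productOfTwoPrimes {n} iso 2≤n with shape n 2≤n
... | prime-power n-pp = inj₁ n-pp
... | product-of-two n-pq = inj₂ n-pq
... | multiple-of-p²q pp pq p≢q n≡ppqm =
  ⊥-elim (lineGraph-obstruction-free (≅-obstruction iso (CyclicGroup.obstruction-p²q n pp pq p≢q n≡ppqm)))
... | multiple-of-pqr pp pq pr p≢q p≢r q≢r n≡pqrm =
  ⊥-elim (lineGraph-obstruction-free (≅-obstruction iso (CyclicGroup.obstruction-pqr n pp pq pr p≢q p≢r q≢r n≡pqrm)))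

mainTheorem10 : (n : ℕ) .{{_ : NonZero n}} → 2 ≤ n →
    (∃[ m ] Σ (SimpleGraph m) (λ Γ → ProperPowerGraph n ≅ LineGraph Γ))
      ⇔ ((∃[ p ] ∃[ t ] (Prime p × 1 ≤ t × n ≡ p ^ t))
         ⊎ (∃[ p ] ∃[ q ] (Prime p × Prime q × p ≢ q × n ≡ p * q)))
mainTheorem10 n 2≤n = mk⇔
  (λ (_ , _ , iso) → lineGraph⇒primePower⊎productOfTwoPrimes iso 2≤n)
  λ { (inj₁ (p , t , pp , _ , refl)) → 0 , edgeless , prime-power≅lineGraph t pp
    ; (inj₂ (p , q , pp , pq , p≢q , refl)) →
        p * q , ProductOfTwoPrimes.Γ pp pq p≢q , ProductOfTwoPrimes.properPowerGraph≅lineGraph pp pq p≢q }
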